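{- Let $i$ be a positive integer and let $G$ be the threshold graph with binary sequence $(0^{2i+1} 1^{3i+3} 0^{2i+1} 1^{2i})$ (so $G$ has $9i+5$ vertices). Then, to within a sign, the characteristic polynomial of (the adjacency matrix of) $G$ is $$P_G(x) = x^{4i} (x+1)^{5i+1} (x+2i+1)\left(x^3 -(7i+2)x^2 -(7i+3)x +12i^3 +18i^2 +6i\right).$$
   Context: A threshold graph on $N$ vertices is coded by a binary sequence $(b_1 b_2 \ldots b_N)$ with $b_1=0$: vertices $v_1,\dots,v_N$ are added in order, and for $j\ge 2$ the vertex $v_j$ is added as an isolated vertex if $b_j=0$ and as a dominating vertex (adjacent to all of $v_1,\dots,v_{j-1}$) if $b_j=1$. Thus for $k<j$, $v_k$ is adjacent to $v_j$ iff $b_j=1$. The notation $(0^{a_1} 1^{a_2} 0^{a_3} 1^{a_4}\cdots)$ denotes the sequence consisting of $a_1$ zeros, followed by $a_2$ ones, followed by $a_3$ zeros, etc. The characteristic polynomial of a graph is that of its adjacency matrix $A$ (with $a_{jk}=1$ iff $v_j,v_k$ adjacent, else $0$). -}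

module Defs where

open import Data.Bool using (Bool; true; false; if_then_else_)
open import Data.Nat as ℕ using (ℕ; zero; suc)
open import Data.Integer as ℤ using (ℤ; +_; 0ℤ; 1ℤ)
open import Data.List using (List; []; _∷_; _++_; replicate; length; lookup)
open import Data.Fin as Fin using (Fin; toℕ; punchIn)
open import Relation.Nullary using (yes; no)
open import Relation.Binary.PropositionalEquality using (_≡_)

-- Polynomials over ℤ as coefficient lists, lowest degree first.
-- Two lists denote the same polynomial iff they agree after removing
-- trailing zero coefficients (see `norm` and `_≈ₚ_`).

Poly : Set
Poly = List ℤ

infixl 6 _+ₚ_
infixl 7 _*ₚ_

_+ₚ_ : Poly → Poly → Poly
[] +ₚ q = q
(a ∷ p) +ₚ [] = a ∷ p
(a ∷ p) +ₚ (b ∷ q) = (a ℤ.+ b) ∷ (p +ₚ q)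

scaleₚ : ℤ → Poly → Poly
scaleₚ c [] = []
scaleₚ c (a ∷ p) = (c ℤ.* a) ∷ scaleₚ c p

negₚ : Poly → Poly
negₚ = scaleₚ (ℤ.- 1ℤ)

_*ₚ_ : Poly → Poly → Poly
[] *ₚ q = []
(a ∷ p) *ₚ q = scaleₚ a q +ₚ (0ℤ ∷ (p *ₚ q))

constₚ : ℤ → Poly
constₚ c = c ∷ []

X : Poly
X = 0ℤ ∷ 1ℤ ∷ []

infixr 8 _^ₚ_
_^ₚ_ : Poly → ℕ → Poly
p ^ₚ zero = constₚ 1ℤ
p ^ₚ suc n = p *ₚ (p ^ₚ n)

norm : Poly → Poly
norm [] = []
norm (a ∷ p) with norm p
... | b ∷ q = a ∷ b ∷ q
... | [] with a ℤ.≟ 0ℤ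
...   | yes _ = []
...   | no _ = a ∷ []

infix 4 _≈ₚ_
_≈ₚ_ : Poly → Poly → Set
p ≈ₚ q = norm p ≡ norm q

sumFin : (n : ℕ) → (Fin n → Poly) → Poly
sumFin zero f = []
sumFin (suc n) f = f Fin.zero +ₚ sumFin n (λ k → f (Fin.suc k))

sign : ℕ → Poly → Poly
sign zero p = p
sign (suc k) p = negₚ (sign k p)

det : (n : ℕ) → (Fin n → Fin n → Poly) → Poly
det zero M = constₚ 1ℤ
det (suc n) M =
  sumFin (suc n) (λ k →
    sign (toℕ k) (M Fin.zero k *ₚ det n (λ r c → M (Fin.suc r) (punchIn k c))))

charPoly : (n : ℕ) → (Fin n → Fin n → ℤ) → Poly
charPoly n A = det n (λ j k →
  (if isDiag j k then X else []) +ₚ negₚ (constₚ (A j k)))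
  where
  isDiag : Fin n → Fin n → Bool
  isDiag j k with toℕ j ℕ.≟ toℕ k
  ... | yes _ = true
  ... | no _ = false

-- Threshold graphs from a binary sequence (b₁ … b_N):
-- for k < j, v_k ~ v_j iff b_j = 1.

thresholdAdj : (s : List Bool) → Fin (length s) → Fin (length s) → ℤ
thresholdAdj s j k with toℕ k ℕ.<? toℕ j | toℕ j ℕ.<? toℕ k
... | yes _ | _     = if lookup s j then 1ℤ else 0ℤ
... | no _  | yes _ = if lookup s k then 1ℤ else 0ℤ
... | no _  | no _  = 0ℤ

thresholdCharPoly : List Bool → Poly
thresholdCharPoly s = charPoly (length s) (thresholdAdj s)

seqG : ℕ → List Bool
seqG i = replicate (2 ℕ.* i ℕ.+ 1) false
      ++ replicate (3 ℕ.* i ℕ.+ 3) true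
      ++ replicate (2 ℕ.* i ℕ.+ 1) false
      ++ replicate (2 ℕ.* i) true

ι : ℕ → ℤ
ι n = + n

claimedPoly : ℕ → Poly
claimedPoly i =
  (X ^ₚ (4 ℕ.* i))
  *ₚ ((X +ₚ constₚ 1ℤ) ^ₚ (5 ℕ.* i ℕ.+ 1))
  *ₚ (X +ₚ constₚ (ι (2 ℕ.* i ℕ.+ 1)))
  *ₚ ( (X ^ₚ 3)
     +ₚ negₚ (scaleₚ (ι (7 ℕ.* i ℕ.+ 2)) (X ^ₚ 2))
     +ₚ negₚ (scaleₚ (ι (7 ℕ.* i ℕ.+ 3)) X)
     +ₚ constₚ (ι (12 ℕ.* i ℕ.* i ℕ.* i ℕ.+ 18 ℕ.* i ℕ.* i ℕ.+ 6 ℕ.* i)))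

-- Write xI - A for a threshold sequence as the matrix with diagonal x whose off-diagonal (j , k)
-- entry is -b_max(j,k). Subtracting its second row from its first and expanding gives, for the
-- characteristic polynomial χ of the threshold graph of a sequence,
--   χ(b₀ b s) = 2(x + b) χ(b₀ s) - (x + b)² χ(s).
-- So a run bᵐ acts on the pair (χ(b₀ s) , χ(s)) by the m-th power of [[2a , -a²] , [1 , 0]] with
-- a = x + b, which has the closed form a^(m-1) [[(m+1)a , -m a²] , [m , -(m-1)a]]. Composing the
-- closed forms for the four runs of the sequence and normalising yields the polynomial, with sign +.

module Submission where

open import Algebra.Bundles using (CommutativeRing; RawRing)
open import Algebra.Solver.Ring.AlmostCommutativeRing
  using (_-Raw-AlmostCommutative⟶_; fromCommutativeRing)
import Algebra.Solver.Ring
open import Data.Bool using (Bool; true; false; if_then_else_)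
open import Data.Empty using (⊥-elim)
open import Data.Fin as Fin using (Fin; toℕ; punchIn)
open import Data.Fin.Properties using (punchInᵢ≢i; toℕ-injective)
open import Data.Integer as ℤ using (ℤ; +_; 0ℤ; 1ℤ)
import Data.Integer.Properties as ℤ
open import Data.List using (List; []; _∷_; _++_; replicate; length; lookup)
import Data.List.Properties as List
open import Data.Maybe using (Maybe; just; nothing)
open import Data.Nat as ℕ using (ℕ; zero; suc; _≥_; s≤s)
import Data.Nat.Properties as ℕ
open import Data.Nat.Tactic.RingSolver using (solve-∀)
open import Data.Product using (_×_; _,_; proj₁; proj₂; Σ-syntax)
open import Data.Sum using (_⊎_; inj₁; inj₂)
import Data.Vec.Functional as V
open import Function using (_∘_)
open import Relation.Binary.PropositionalEquality
  using (_≡_; _≢_; refl; sym; trans; cong; cong₂; module ≡-Reasoning)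
open import Relation.Binary.Definitions using (tri<; tri≈; tri>)
import Relation.Binary.Reasoning.Setoid
open import Relation.Binary.Structures using (IsEquivalence)
open import Relation.Nullary using (yes; no)

open import Algebra.Properties.CommutativeSemigroup ℤ.+-commutativeSemigroup
  renaming (interchange to ℤ-interchange)

open import Defs

pattern 1F = Fin.suc Fin.zero

-- Polynomials up to trailing zeros

coeff : Poly → ℕ → ℤ
coeff []      _       = 0ℤ
coeff (a ∷ p) zero    = a
coeff (a ∷ p) (suc n) = coeff p n

infix 4 _≃_
record _≃_ (p q : Poly) : Set where
  constructor mk≃
  field coeff-≡ : ∀ n → coeff p n ≡ coeff q n
open _≃_

≃-refl : ∀ {p} → p ≃ p
≃-refl = mk≃ λ _ → refl

≃-sym : ∀ {p q} → p ≃ q → q ≃ p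
≃-sym e = mk≃ λ n → sym (coeff-≡ e n)

≃-trans : ∀ {p q r} → p ≃ q → q ≃ r → p ≃ r
≃-trans e f = mk≃ λ n → trans (coeff-≡ e n) (coeff-≡ f n)

≡⇒≃ : ∀ {p q} → p ≡ q → p ≃ q
≡⇒≃ refl = ≃-refl

∷-cong : ∀ {a b p q} → a ≡ b → p ≃ q → a ∷ p ≃ b ∷ q
∷-cong a≡b p≃q = mk≃ λ { zero → a≡b ; (suc n) → coeff-≡ p≃q n }

[0]≃[] : 0ℤ ∷ [] ≃ []
[0]≃[] = mk≃ λ { zero → refl ; (suc n) → refl }

coeff-+ : ∀ p q n → coeff (p +ₚ q) n ≡ coeff p n ℤ.+ coeff q n
coeff-+ []      q       n       = sym (ℤ.+-identityˡ _)
coeff-+ (a ∷ p) []      n       = sym (ℤ.+-identityʳ _)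
coeff-+ (a ∷ p) (b ∷ q) zero    = refl
coeff-+ (a ∷ p) (b ∷ q) (suc n) = coeff-+ p q n

coeff-scale : ∀ c p n → coeff (scaleₚ c p) n ≡ c ℤ.* coeff p n
coeff-scale c []      n       = sym (ℤ.*-zeroʳ c)
coeff-scale c (a ∷ p) zero    = refl
coeff-scale c (a ∷ p) (suc n) = coeff-scale c p n

coeff-neg : ∀ p n → coeff (negₚ p) n ≡ ℤ.- coeff p n
coeff-neg p n = trans (coeff-scale _ p n) (ℤ.-1*i≡-i _)

+ₚ-cong : ∀ {p p′ q q′} → p ≃ p′ → q ≃ q′ → p +ₚ q ≃ p′ +ₚ q′
+ₚ-cong {p} {p′} {q} {q′} e f = mk≃ λ n → begin
  coeff (p +ₚ q) n           ≡⟨ coeff-+ p q n ⟩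
  coeff p n ℤ.+ coeff q n    ≡⟨ cong₂ ℤ._+_ (coeff-≡ e n) (coeff-≡ f n) ⟩
  coeff p′ n ℤ.+ coeff q′ n  ≡⟨ coeff-+ p′ q′ n ⟨
  coeff (p′ +ₚ q′) n         ∎
  where open ≡-Reasoning

+ₚ-comm : ∀ p q → p +ₚ q ≃ q +ₚ p
+ₚ-comm p q = mk≃ λ n → begin
  coeff (p +ₚ q) n         ≡⟨ coeff-+ p q n ⟩
  coeff p n ℤ.+ coeff q n  ≡⟨ ℤ.+-comm (coeff p n) _ ⟩
  coeff q n ℤ.+ coeff p n  ≡⟨ coeff-+ q p n ⟨
  coeff (q +ₚ p) n         ∎
  where open ≡-Reasoning

+ₚ-assoc : ∀ p q r → (p +ₚ q) +ₚ r ≃ p +ₚ (q +ₚ r)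
+ₚ-assoc p q r = mk≃ λ n → begin
  coeff ((p +ₚ q) +ₚ r) n                      ≡⟨ coeff-+ (p +ₚ q) r n ⟩
  coeff (p +ₚ q) n ℤ.+ coeff r n               ≡⟨ cong (ℤ._+ coeff r n) (coeff-+ p q n) ⟩
  (coeff p n ℤ.+ coeff q n) ℤ.+ coeff r n      ≡⟨ ℤ.+-assoc (coeff p n) _ _ ⟩
  coeff p n ℤ.+ (coeff q n ℤ.+ coeff r n)      ≡⟨ cong (ℤ._+_ (coeff p n)) (coeff-+ q r n) ⟨
  coeff p n ℤ.+ coeff (q +ₚ r) n               ≡⟨ coeff-+ p (q +ₚ r) n ⟨
  coeff (p +ₚ (q +ₚ r)) n                      ∎
  where open ≡-Reasoning

+ₚ-identityʳ : ∀ p → p +ₚ [] ≃ p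
+ₚ-identityʳ p = mk≃ λ n → trans (coeff-+ p [] n) (ℤ.+-identityʳ _)

+ₚ-inverseˡ : ∀ p → negₚ p +ₚ p ≃ []
+ₚ-inverseˡ p = mk≃ λ n → begin
  coeff (negₚ p +ₚ p) n               ≡⟨ coeff-+ (negₚ p) p n ⟩
  coeff (negₚ p) n ℤ.+ coeff p n      ≡⟨ cong (ℤ._+ coeff p n) (coeff-neg p n) ⟩
  ℤ.- coeff p n ℤ.+ coeff p n         ≡⟨ ℤ.+-inverseˡ (coeff p n) ⟩
  0ℤ                                  ∎
  where open ≡-Reasoning

+ₚ-inverseʳ : ∀ p → p +ₚ negₚ p ≃ []
+ₚ-inverseʳ p = ≃-trans (+ₚ-comm p (negₚ p)) (+ₚ-inverseˡ p)

scaleₚ-cong : ∀ c {p q} → p ≃ q → scaleₚ c p ≃ scaleₚ c q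
scaleₚ-cong c {p} {q} e = mk≃ λ n →
  trans (coeff-scale c p n) (trans (cong (c ℤ.*_) (coeff-≡ e n)) (sym (coeff-scale c q n)))

negₚ-cong : ∀ {p q} → p ≃ q → negₚ p ≃ negₚ q
negₚ-cong = scaleₚ-cong _

scaleₚ-distribˡ : ∀ c p q → scaleₚ c (p +ₚ q) ≃ scaleₚ c p +ₚ scaleₚ c q
scaleₚ-distribˡ c p q = mk≃ λ n → begin
  coeff (scaleₚ c (p +ₚ q)) n                         ≡⟨ coeff-scale c (p +ₚ q) n ⟩
  c ℤ.* coeff (p +ₚ q) n                              ≡⟨ cong (c ℤ.*_) (coeff-+ p q n) ⟩
  c ℤ.* (coeff p n ℤ.+ coeff q n)                     ≡⟨ ℤ.*-distribˡ-+ c (coeff p n) _ ⟩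
  c ℤ.* coeff p n ℤ.+ c ℤ.* coeff q n                 ≡⟨ cong₂ ℤ._+_ (coeff-scale c p n) (coeff-scale c q n) ⟨
  coeff (scaleₚ c p) n ℤ.+ coeff (scaleₚ c q) n       ≡⟨ coeff-+ (scaleₚ c p) (scaleₚ c q) n ⟨
  coeff (scaleₚ c p +ₚ scaleₚ c q) n                  ∎
  where open ≡-Reasoning

scaleₚ-distribʳ : ∀ c d p → scaleₚ (c ℤ.+ d) p ≃ scaleₚ c p +ₚ scaleₚ d p
scaleₚ-distribʳ c d p = mk≃ λ n → begin
  coeff (scaleₚ (c ℤ.+ d) p) n                        ≡⟨ coeff-scale (c ℤ.+ d) p n ⟩
  (c ℤ.+ d) ℤ.* coeff p n                             ≡⟨ ℤ.*-distribʳ-+ (coeff p n) c d ⟩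
  c ℤ.* coeff p n ℤ.+ d ℤ.* coeff p n                 ≡⟨ cong₂ ℤ._+_ (coeff-scale c p n) (coeff-scale d p n) ⟨
  coeff (scaleₚ c p) n ℤ.+ coeff (scaleₚ d p) n       ≡⟨ coeff-+ (scaleₚ c p) (scaleₚ d p) n ⟨
  coeff (scaleₚ c p +ₚ scaleₚ d p) n                  ∎
  where open ≡-Reasoning

scaleₚ-assoc : ∀ c d p → scaleₚ c (scaleₚ d p) ≃ scaleₚ (c ℤ.* d) p
scaleₚ-assoc c d p = mk≃ λ n → begin
  coeff (scaleₚ c (scaleₚ d p)) n   ≡⟨ coeff-scale c (scaleₚ d p) n ⟩
  c ℤ.* coeff (scaleₚ d p) n        ≡⟨ cong (c ℤ.*_) (coeff-scale d p n) ⟩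
  c ℤ.* (d ℤ.* coeff p n)           ≡⟨ ℤ.*-assoc c d (coeff p n) ⟨
  (c ℤ.* d) ℤ.* coeff p n           ≡⟨ coeff-scale (c ℤ.* d) p n ⟨
  coeff (scaleₚ (c ℤ.* d) p) n      ∎
  where open ≡-Reasoning

scaleₚ-identity : ∀ p → scaleₚ 1ℤ p ≃ p
scaleₚ-identity p = mk≃ λ n → trans (coeff-scale 1ℤ p n) (ℤ.*-identityˡ (coeff p n))

scaleₚ-zero : ∀ p → scaleₚ 0ℤ p ≃ []
scaleₚ-zero p = mk≃ λ n → trans (coeff-scale 0ℤ p n) (ℤ.*-zeroˡ (coeff p n))

+ₚ-interchange : ∀ a b c d → (a +ₚ b) +ₚ (c +ₚ d) ≃ (a +ₚ c) +ₚ (b +ₚ d)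
+ₚ-interchange a b c d = mk≃ λ n → begin
  coeff ((a +ₚ b) +ₚ (c +ₚ d)) n
    ≡⟨ coeff-+ (a +ₚ b) (c +ₚ d) n ⟩
  coeff (a +ₚ b) n ℤ.+ coeff (c +ₚ d) n
    ≡⟨ cong₂ ℤ._+_ (coeff-+ a b n) (coeff-+ c d n) ⟩
  (coeff a n ℤ.+ coeff b n) ℤ.+ (coeff c n ℤ.+ coeff d n)
    ≡⟨ ℤ-interchange (coeff a n) (coeff b n) (coeff c n) (coeff d n) ⟩
  (coeff a n ℤ.+ coeff c n) ℤ.+ (coeff b n ℤ.+ coeff d n)
    ≡⟨ cong₂ ℤ._+_ (coeff-+ a c n) (coeff-+ b d n) ⟨
  coeff (a +ₚ c) n ℤ.+ coeff (b +ₚ d) n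
    ≡⟨ coeff-+ (a +ₚ c) (b +ₚ d) n ⟨
  coeff ((a +ₚ c) +ₚ (b +ₚ d)) n
    ∎
  where open ≡-Reasoning

*ₚ-congʳ : ∀ p {q q′} → q ≃ q′ → p *ₚ q ≃ p *ₚ q′
*ₚ-congʳ []      e = ≃-refl
*ₚ-congʳ (a ∷ p) e = +ₚ-cong (scaleₚ-cong a e) (∷-cong refl (*ₚ-congʳ p e))

*ₚ-zeroʳ : ∀ p → p *ₚ [] ≃ []
*ₚ-zeroʳ []      = ≃-refl
*ₚ-zeroʳ (a ∷ p) = ≃-trans (∷-cong refl (*ₚ-zeroʳ p)) [0]≃[]

*ₚ-consʳ : ∀ p b q → p *ₚ (b ∷ q) ≃ scaleₚ b p +ₚ (0ℤ ∷ (p *ₚ q))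
*ₚ-consʳ []      b q = ≃-sym [0]≃[]
*ₚ-consʳ (a ∷ p) b q = ∷-cong head tail
  where
  head : a ℤ.* b ℤ.+ 0ℤ ≡ b ℤ.* a ℤ.+ 0ℤ
  head = cong (ℤ._+ 0ℤ) (ℤ.*-comm a b)
  tail : scaleₚ a q +ₚ p *ₚ (b ∷ q) ≃ scaleₚ b p +ₚ (scaleₚ a q +ₚ (0ℤ ∷ (p *ₚ q)))
  tail = ≃-trans (+ₚ-cong (≃-refl {scaleₚ a q}) (*ₚ-consʳ p b q))
        (≃-trans (≃-sym (+ₚ-assoc (scaleₚ a q) (scaleₚ b p) _))
        (≃-trans (+ₚ-cong (+ₚ-comm (scaleₚ a q) (scaleₚ b p)) ≃-refl)
                 (+ₚ-assoc (scaleₚ b p) (scaleₚ a q) _)))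

*ₚ-comm : ∀ p q → p *ₚ q ≃ q *ₚ p
*ₚ-comm []      q = ≃-sym (*ₚ-zeroʳ q)
*ₚ-comm (a ∷ p) q =
  ≃-trans (+ₚ-cong ≃-refl (∷-cong refl (*ₚ-comm p q))) (≃-sym (*ₚ-consʳ q a p))

*ₚ-cong : ∀ {p p′ q q′} → p ≃ p′ → q ≃ q′ → p *ₚ q ≃ p′ *ₚ q′
*ₚ-cong {p} {p′} {q} {q′} e f =
  ≃-trans (*ₚ-comm p q) (≃-trans (*ₚ-congʳ q e) (≃-trans (*ₚ-comm q p′) (*ₚ-congʳ p′ f)))

*ₚ-distribʳ : ∀ p p′ q → (p +ₚ p′) *ₚ q ≃ p *ₚ q +ₚ p′ *ₚ q
*ₚ-distribʳ []      p′       q = ≃-refl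
*ₚ-distribʳ (a ∷ p) []       q = ≃-sym (+ₚ-identityʳ _)
*ₚ-distribʳ (a ∷ p) (b ∷ p′) q =
  ≃-trans (+ₚ-cong (scaleₚ-distribʳ a b q) (∷-cong refl (*ₚ-distribʳ p p′ q)))
          (≃-sym (+ₚ-interchange (scaleₚ a q) (0ℤ ∷ (p *ₚ q)) (scaleₚ b q) (0ℤ ∷ (p′ *ₚ q))))

*ₚ-distribˡ : ∀ p q q′ → p *ₚ (q +ₚ q′) ≃ p *ₚ q +ₚ p *ₚ q′
*ₚ-distribˡ []      q q′ = ≃-refl
*ₚ-distribˡ (a ∷ p) q q′ =
  ≃-trans (+ₚ-cong (scaleₚ-distribˡ a q q′) (∷-cong refl (*ₚ-distribˡ p q q′)))
          (+ₚ-interchange (scaleₚ a q) (scaleₚ a q′) (0ℤ ∷ (p *ₚ q)) (0ℤ ∷ (p *ₚ q′)))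

scaleₚ-*ₚ : ∀ c p q → scaleₚ c p *ₚ q ≃ scaleₚ c (p *ₚ q)
scaleₚ-*ₚ c []      q = ≃-refl
scaleₚ-*ₚ c (a ∷ p) q =
  ≃-trans (+ₚ-cong (≃-sym (scaleₚ-assoc c a q)) (∷-cong (sym (ℤ.*-zeroʳ c)) (scaleₚ-*ₚ c p q)))
          (≃-sym (scaleₚ-distribˡ c (scaleₚ a q) (0ℤ ∷ (p *ₚ q))))

*ₚ-assoc : ∀ p q r → (p *ₚ q) *ₚ r ≃ p *ₚ (q *ₚ r)
*ₚ-assoc []      q r = ≃-refl
*ₚ-assoc (a ∷ p) q r =
  ≃-trans (*ₚ-distribʳ (scaleₚ a q) (0ℤ ∷ (p *ₚ q)) r)
          (+ₚ-cong (scaleₚ-*ₚ a q r)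
                   (≃-trans (+ₚ-cong (scaleₚ-zero r) ≃-refl) (∷-cong refl (*ₚ-assoc p q r))))

*ₚ-identityˡ : ∀ p → constₚ 1ℤ *ₚ p ≃ p
*ₚ-identityˡ p = ≃-trans (+ₚ-cong (scaleₚ-identity p) [0]≃[]) (+ₚ-identityʳ p)

*ₚ-identityʳ : ∀ p → p *ₚ constₚ 1ℤ ≃ p
*ₚ-identityʳ p = ≃-trans (*ₚ-comm p _) (*ₚ-identityˡ p)

ℤ[X] : CommutativeRing _ _
ℤ[X] = record
  { Carrier = Poly ; _≈_ = _≃_ ; _+_ = _+ₚ_ ; _*_ = _*ₚ_ ; -_ = negₚ ; 0# = [] ; 1# = constₚ 1ℤ
  ; isCommutativeRing = record
    { isRing = record
      { +-isAbelianGroup = record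
        { isGroup = record
          { isMonoid = record
            { isSemigroup = record
              { isMagma = record { isEquivalence = ≃-isEquivalence ; ∙-cong = +ₚ-cong }
              ; assoc = +ₚ-assoc }
            ; identity = (λ _ → ≃-refl) , +ₚ-identityʳ }
          ; inverse = +ₚ-inverseˡ , +ₚ-inverseʳ
          ; ⁻¹-cong = negₚ-cong }
        ; comm = +ₚ-comm }
      ; *-cong = *ₚ-cong
      ; *-assoc = *ₚ-assoc
      ; *-identity = *ₚ-identityˡ , *ₚ-identityʳ
      ; distrib = *ₚ-distribˡ , λ p q r → *ₚ-distribʳ q r p }
    ; *-comm = *ₚ-comm } }
  where
  ≃-isEquivalence : IsEquivalence _≃_
  ≃-isEquivalence = record { refl = ≃-refl ; sym = ≃-sym ; trans = ≃-trans }

module ≃-Reasoning = Relation.Binary.Reasoning.Setoid (CommutativeRing.setoid ℤ[X])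

constₚ-homomorphism :
  CommutativeRing.rawRing ℤ.+-*-commutativeRing -Raw-AlmostCommutative⟶ fromCommutativeRing ℤ[X]
constₚ-homomorphism = record
  { ⟦_⟧    = constₚ
  ; +-homo = λ _ _ → ≃-refl
  ; *-homo = λ a b → ∷-cong (sym (ℤ.+-identityʳ (a ℤ.* b))) ≃-refl
  ; -‿homo = λ a → ∷-cong (sym (ℤ.-1*i≡-i a)) ≃-refl
  ; 0-homo = [0]≃[]
  ; 1-homo = ≃-refl }

≟-constₚ : ∀ a b → Maybe (constₚ a ≃ constₚ b)
≟-constₚ a b with a ℤ.≟ b
... | yes refl = just ≃-refl
... | no _     = nothing

open Algebra.Solver.Ring _ _ constₚ-homomorphism ≟-constₚ
  using (Polynomial; solve; _:=_; _:+_; _:*_; :-_; con)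

normCons : ℤ → Poly → Poly
normCons a (b ∷ q) = a ∷ b ∷ q
normCons a [] with a ℤ.≟ 0ℤ
... | yes _ = []
... | no _  = a ∷ []

norm-∷ : ∀ a p → norm (a ∷ p) ≡ normCons a (norm p)
norm-∷ a p with norm p
... | b ∷ q = refl
... | [] with a ℤ.≟ 0ℤ
...   | yes _ = refl
...   | no _  = refl

tailₚ : Poly → Poly
tailₚ []      = []
tailₚ (_ ∷ p) = p

≃-tail : ∀ {p q} → p ≃ q → tailₚ p ≃ tailₚ q
≃-tail {p} {q} e = mk≃ λ n → trans (coeff-tail p n) (trans (coeff-≡ e (suc n)) (sym (coeff-tail q n)))
  where
  coeff-tail : ∀ p n → coeff (tailₚ p) n ≡ coeff p (suc n)
  coeff-tail []      n = refl
  coeff-tail (_ ∷ p) n = refl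

≃⇒≈ₚ : ∀ {p q} → p ≃ q → p ≈ₚ q
≃⇒≈ₚ {[]}    {[]}    e = refl
≃⇒≈ₚ {[]}    {b ∷ q} e = trans (cong₂ normCons (coeff-≡ e 0) (≃⇒≈ₚ {[]} {q} (≃-tail e))) (sym (norm-∷ b q))
≃⇒≈ₚ {a ∷ p} {[]}    e = trans (norm-∷ a p) (cong₂ normCons (coeff-≡ e 0) (≃⇒≈ₚ {p} {[]} (≃-tail e)))
≃⇒≈ₚ {a ∷ p} {b ∷ q} e =
  trans (norm-∷ a p) (trans (cong₂ normCons (coeff-≡ e 0) (≃⇒≈ₚ {p} {q} (≃-tail e))) (sym (norm-∷ b q)))

-- Determinants

sumFin-cong : ∀ n {f g : Fin n → Poly} → (∀ k → f k ≃ g k) → sumFin n f ≃ sumFin n g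
sumFin-cong zero    e = ≃-refl
sumFin-cong (suc n) e = +ₚ-cong (e Fin.zero) (sumFin-cong n (λ k → e (Fin.suc k)))

sumFin-zero : ∀ n {f : Fin n → Poly} → (∀ k → f k ≃ []) → sumFin n f ≃ []
sumFin-zero zero    e = ≃-refl
sumFin-zero (suc n) e = +ₚ-cong (e Fin.zero) (sumFin-zero n (λ k → e (Fin.suc k)))

sumFin-+ₚ : ∀ n (f g : Fin n → Poly) → sumFin n (λ k → f k +ₚ g k) ≃ sumFin n f +ₚ sumFin n g
sumFin-+ₚ zero    f g = ≃-refl
sumFin-+ₚ (suc n) f g =
  ≃-trans (+ₚ-cong ≃-refl (sumFin-+ₚ n _ _))
          (+ₚ-interchange (f Fin.zero) (g Fin.zero) (sumFin n (λ k → f (Fin.suc k))) (sumFin n (λ k → g (Fin.suc k))))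

sumFin-*ₚ : ∀ n p (f : Fin n → Poly) → p *ₚ sumFin n f ≃ sumFin n (λ k → p *ₚ f k)
sumFin-*ₚ zero    p f = *ₚ-zeroʳ p
sumFin-*ₚ (suc n) p f = ≃-trans (*ₚ-distribˡ p _ _) (+ₚ-cong ≃-refl (sumFin-*ₚ n p _))

sumFin-negₚ : ∀ n (f : Fin n → Poly) → negₚ (sumFin n f) ≃ sumFin n (λ k → negₚ (f k))
sumFin-negₚ zero    f = ≃-refl
sumFin-negₚ (suc n) f =
  ≃-trans (scaleₚ-distribˡ _ (f Fin.zero) _) (+ₚ-cong ≃-refl (sumFin-negₚ n _))

sumFin-punchIn : ∀ m (f : Fin (suc m) → Poly) k → sumFin (suc m) f ≃ f k +ₚ sumFin m (λ l → f (punchIn k l))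
sumFin-punchIn m       f Fin.zero    = ≃-refl
sumFin-punchIn (suc m) f (Fin.suc k) = begin
  f₀ +ₚ sumFin (suc m) (λ j → f (Fin.suc j))  ≈⟨ +ₚ-cong (≃-refl {f₀}) (sumFin-punchIn m (λ j → f (Fin.suc j)) k) ⟩
  f₀ +ₚ (fₖ +ₚ rest)                          ≈⟨ solve 3 (λ a b c → a :+ (b :+ c) := b :+ (a :+ c)) ≃-refl f₀ fₖ rest ⟩
  fₖ +ₚ (f₀ +ₚ rest)                          ∎
  where
  open ≃-Reasoning
  f₀ = f Fin.zero
  fₖ = f (Fin.suc k)
  rest = sumFin m (λ l → f (Fin.suc (punchIn k l)))

sumFin-swap : ∀ m n (F : Fin m → Fin n → Poly) →
  sumFin m (λ k → sumFin n (F k)) ≃ sumFin n (λ b → sumFin m (λ k → F k b))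
sumFin-swap zero    n F = ≃-sym (sumFin-zero n (λ _ → ≃-refl))
sumFin-swap (suc m) n F =
  ≃-trans (+ₚ-cong ≃-refl (sumFin-swap m n (λ k → F (Fin.suc k))))
          (≃-sym (sumFin-+ₚ n (F Fin.zero) (λ b → sumFin m (λ k → F (Fin.suc k) b))))

sign-cong : ∀ k {p q} → p ≃ q → sign k p ≃ sign k q
sign-cong zero    e = e
sign-cong (suc k) e = negₚ-cong (sign-cong k e)

sign-zero : ∀ k {p} → p ≃ [] → sign k p ≃ []
sign-zero zero    e = e
sign-zero (suc k) e = negₚ-cong (sign-zero k e)

sign-+ : ∀ a b p → sign (a ℕ.+ b) p ≡ sign a (sign b p)
sign-+ zero    b p = refl
sign-+ (suc a) b p = cong negₚ (sign-+ a b p)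

sign-+ₚ : ∀ k p q → sign k (p +ₚ q) ≃ sign k p +ₚ sign k q
sign-+ₚ zero    p q = ≃-refl
sign-+ₚ (suc k) p q = ≃-trans (negₚ-cong (sign-+ₚ k p q)) (scaleₚ-distribˡ _ (sign k p) (sign k q))

sign-*ₚ : ∀ k p q → p *ₚ sign k q ≃ sign k (p *ₚ q)
sign-*ₚ zero    p q = ≃-refl
sign-*ₚ (suc k) p q =
  ≃-trans (solve 2 (λ p q → p :* (:- q) := :- (p :* q)) ≃-refl p (sign k q)) (negₚ-cong (sign-*ₚ k p q))

sign-sumFin : ∀ k n (f : Fin n → Poly) → sign k (sumFin n f) ≃ sumFin n (λ j → sign k (f j))
sign-sumFin zero    n f = ≃-refl
sign-sumFin (suc k) n f = ≃-trans (negₚ-cong (sign-sumFin k n f)) (sumFin-negₚ n _)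

sign-cancel : ∀ a b c d p → suc (a ℕ.+ b) ≡ c ℕ.+ d → sign a (sign b p) +ₚ sign c (sign d p) ≃ []
sign-cancel a b c d p odd = begin
  sign a (sign b p) +ₚ sign c (sign d p)       ≡⟨ cong (sign a (sign b p) +ₚ_) (sym (sign-+ c d p)) ⟩
  sign a (sign b p) +ₚ sign (c ℕ.+ d) p        ≡⟨ cong (λ t → sign a (sign b p) +ₚ sign t p) (sym odd) ⟩
  sign a (sign b p) +ₚ negₚ (sign (a ℕ.+ b) p) ≡⟨ cong (λ t → sign a (sign b p) +ₚ negₚ t) (sign-+ a b p) ⟩
  sign a (sign b p) +ₚ negₚ (sign a (sign b p)) ≈⟨ +ₚ-inverseʳ (sign a (sign b p)) ⟩
  []                                            ∎
  where open ≃-Reasoning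

det-cong : ∀ n {M N : Fin n → Fin n → Poly} → (∀ r c → M r c ≃ N r c) → det n M ≃ det n N
det-cong zero    e = ≃-refl
det-cong (suc n) e = sumFin-cong (suc n) λ k → sign-cong (toℕ k)
  (*ₚ-cong (e Fin.zero k) (det-cong n (λ r c → e (Fin.suc r) (punchIn k c))))

p+p≃0⇒p≃0 : ∀ {p} → p +ₚ p ≃ [] → p ≃ []
p+p≃0⇒p≃0 {p} e = mk≃ λ n → a+a≡0⇒a≡0 (coeff p n) (trans (sym (coeff-+ p p n)) (coeff-≡ e n))
  where
  a+a≡0⇒a≡0 : ∀ a → a ℤ.+ a ≡ 0ℤ → a ≡ 0ℤ
  a+a≡0⇒a≡0 a a+a≡0 with ℤ.i*j≡0⇒i≡0∨j≡0 (+ 2) (trans (ℤ.*-distribʳ-+ a 1ℤ 1ℤ)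
                            (trans (cong₂ ℤ._+_ (ℤ.*-identityˡ a) (ℤ.*-identityˡ a)) a+a≡0))
  ... | inj₂ a≡0 = a≡0

offDiagonalSum : ∀ m → (Fin (suc m) → Fin (suc m) → Poly) → Poly
offDiagonalSum m F = sumFin (suc m) (λ k → sumFin m (λ l → F k (punchIn k l)))

offDiagonalSum-transpose : ∀ m (F : Fin (suc m) → Fin (suc m) → Poly) →
  offDiagonalSum m F ≃ offDiagonalSum m (λ k b → F b k)
offDiagonalSum-transpose m F = begin
  S                        ≈⟨ solve 2 (λ d s → s := (d :+ s) :+ (:- d)) ≃-refl D S ⟩
  (D +ₚ S) +ₚ negₚ D       ≈⟨ +ₚ-cong (≃-trans (≃-sym (full≃ F)) (≃-trans (sumFin-swap (suc m) (suc m) F) (full≃ Fᵀ))) ≃-refl ⟩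
  (D +ₚ Sᵀ) +ₚ negₚ D      ≈⟨ solve 2 (λ d s → (d :+ s) :+ (:- d) := s) ≃-refl D Sᵀ ⟩
  Sᵀ                       ∎
  where
  open ≃-Reasoning
  Fᵀ : Fin (suc m) → Fin (suc m) → Poly
  Fᵀ k b = F b k
  S = offDiagonalSum m F
  Sᵀ = offDiagonalSum m Fᵀ
  D = sumFin (suc m) (λ k → F k k)
  full≃ : ∀ G → sumFin (suc m) (λ k → sumFin (suc m) (G k)) ≃ sumFin (suc m) (λ k → G k k) +ₚ offDiagonalSum m G
  full≃ G = ≃-trans (sumFin-cong (suc m) (λ k → sumFin-punchIn m (G k) k)) (sumFin-+ₚ (suc m) (λ k → G k k) (λ k → sumFin m (λ l → G k (punchIn k l))))

offDiagonalSum-antisym : ∀ m (F : Fin (suc m) → Fin (suc m) → Poly) →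
  (∀ k b → k ≢ b → F k b +ₚ F b k ≃ []) → offDiagonalSum m F ≃ []
offDiagonalSum-antisym m F anti = p+p≃0⇒p≃0 (begin
  S +ₚ S                                                     ≈⟨ +ₚ-cong (≃-refl {S}) (offDiagonalSum-transpose m F) ⟩
  S +ₚ offDiagonalSum m (λ k b → F b k)
    ≈⟨ ≃-sym (sumFin-+ₚ (suc m) (λ k → sumFin m (row k)) (λ k → sumFin m (col k))) ⟩
  sumFin (suc m) (λ k → sumFin m (row k) +ₚ sumFin m (col k))
    ≈⟨ sumFin-cong (suc m) (λ k → ≃-sym (sumFin-+ₚ m (row k) (col k))) ⟩
  sumFin (suc m) (λ k → sumFin m (λ l → F k (punchIn k l) +ₚ F (punchIn k l) k))
    ≈⟨ sumFin-zero (suc m) (λ k → sumFin-zero m (λ l → anti k (punchIn k l) (punchInᵢ≢i k l ∘ sym))) ⟩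
  []                                                         ∎)
  where
  open ≃-Reasoning
  S = offDiagonalSum m F
  row col : Fin (suc m) → Fin m → Poly
  row k l = F k (punchIn k l)
  col k l = F (punchIn k l) k

-- A total version of `punchOut`: `punchOut′ k b` is the position of `b` once `k` is removed.
punchOut′ : ∀ {n} → Fin (suc (suc n)) → Fin (suc (suc n)) → Fin (suc n)
punchOut′         Fin.zero    Fin.zero    = Fin.zero
punchOut′         Fin.zero    (Fin.suc b) = b
punchOut′         (Fin.suc k) Fin.zero    = Fin.zero
punchOut′ {zero}  (Fin.suc k) (Fin.suc b) = Fin.zero
punchOut′ {suc n} (Fin.suc k) (Fin.suc b) = Fin.suc (punchOut′ k b)

punchOut′-punchIn : ∀ {n} (k : Fin (suc (suc n))) l → punchOut′ k (punchIn k l) ≡ l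
punchOut′-punchIn         Fin.zero    l           = refl
punchOut′-punchIn         (Fin.suc k) Fin.zero    = refl
punchOut′-punchIn {suc n} (Fin.suc k) (Fin.suc l) = cong Fin.suc (punchOut′-punchIn k l)

punchIn-punchOut′-comm : ∀ {n} (k b : Fin (suc (suc n))) → k ≢ b → ∀ c →
  punchIn k (punchIn (punchOut′ k b) c) ≡ punchIn b (punchIn (punchOut′ b k) c)
punchIn-punchOut′-comm         Fin.zero    Fin.zero    k≢b c           = ⊥-elim (k≢b refl)
punchIn-punchOut′-comm         Fin.zero    (Fin.suc b) k≢b c           = refl
punchIn-punchOut′-comm         (Fin.suc k) Fin.zero    k≢b c           = refl
punchIn-punchOut′-comm {suc n} (Fin.suc k) (Fin.suc b) k≢b Fin.zero    = refl
punchIn-punchOut′-comm {suc n} (Fin.suc k) (Fin.suc b) k≢b (Fin.suc c) =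
  cong Fin.suc (punchIn-punchOut′-comm k b (k≢b ∘ cong Fin.suc) c)

punchOut′-parity : ∀ {n} (k b : Fin (suc (suc n))) → toℕ k ℕ.< toℕ b →
  suc (toℕ k ℕ.+ toℕ (punchOut′ k b)) ≡ toℕ b ℕ.+ toℕ (punchOut′ b k)
punchOut′-parity         Fin.zero    (Fin.suc b) k<b = sym (ℕ.+-identityʳ _)
punchOut′-parity {zero}  1F          1F          (s≤s ())
punchOut′-parity {suc n} (Fin.suc k) (Fin.suc b) (s≤s k<b) = cong suc (begin
  suc (toℕ k ℕ.+ suc (toℕ (punchOut′ k b)))  ≡⟨ cong suc (ℕ.+-suc (toℕ k) _) ⟩
  suc (suc (toℕ k ℕ.+ toℕ (punchOut′ k b)))  ≡⟨ cong suc (punchOut′-parity k b k<b) ⟩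
  suc (toℕ b ℕ.+ toℕ (punchOut′ b k))        ≡⟨ ℕ.+-suc (toℕ b) _ ⟨
  toℕ b ℕ.+ suc (toℕ (punchOut′ b k))        ∎)
  where open ≡-Reasoning

-- Expanding twice writes the determinant as an off-diagonal sum over ordered pairs of columns
-- (k , b) of the first two rows; if these rows agree, the terms for (k , b) and (b , k) cancel.
det-repeatedRow : ∀ n (M : Fin (suc (suc n)) → Fin (suc (suc n)) → Poly) →
  (∀ c → M Fin.zero c ≃ M 1F c) → det (suc (suc n)) M ≃ []
det-repeatedRow n M row₀≃row₁ =
  ≃-trans (sumFin-cong (suc (suc n)) expand) (offDiagonalSum-antisym (suc n) term antisym)
  where
  open ≃-Reasoning
  A : Fin (suc (suc n)) → Poly
  A = M Fin.zero
  minor₂ : Fin (suc (suc n)) → Fin (suc n) → Fin n → Fin n → Poly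
  minor₂ k l r c = M (Fin.suc (Fin.suc r)) (punchIn k (punchIn l c))
  term : Fin (suc (suc n)) → Fin (suc (suc n)) → Poly
  term k b = sign (toℕ k) (sign (toℕ (punchOut′ k b)) (A k *ₚ (A b *ₚ det n (minor₂ k (punchOut′ k b)))))

  expand : ∀ k → sign (toℕ k) (A k *ₚ det (suc n) (λ r c → M (Fin.suc r) (punchIn k c)))
                 ≃ sumFin (suc n) (λ l → term k (punchIn k l))
  expand k = begin
    sign (toℕ k) (A k *ₚ sumFin (suc n) (λ l → sign (toℕ l) (B l *ₚ D l)))
      ≈⟨ sign-cong (toℕ k) (sumFin-*ₚ (suc n) (A k) (λ l → sign (toℕ l) (B l *ₚ D l))) ⟩
    sign (toℕ k) (sumFin (suc n) (λ l → A k *ₚ sign (toℕ l) (B l *ₚ D l)))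
      ≈⟨ sign-sumFin (toℕ k) (suc n) (λ l → A k *ₚ sign (toℕ l) (B l *ₚ D l)) ⟩
    sumFin (suc n) (λ l → sign (toℕ k) (A k *ₚ sign (toℕ l) (B l *ₚ D l)))
      ≈⟨ sumFin-cong (suc n) (λ l → sign-cong (toℕ k) (sign-*ₚ (toℕ l) (A k) (B l *ₚ D l))) ⟩
    sumFin (suc n) (λ l → sign (toℕ k) (sign (toℕ l) (A k *ₚ (B l *ₚ D l))))
      ≈⟨ sumFin-cong (suc n) (λ l → sign-cong (toℕ k) (sign-cong (toℕ l)
           (*ₚ-cong (≃-refl {A k}) (*ₚ-cong (≃-sym (row₀≃row₁ (punchIn k l))) (≃-refl {D l}))))) ⟩
    sumFin (suc n) (λ l → sign (toℕ k) (sign (toℕ l) (A k *ₚ (A (punchIn k l) *ₚ D l))))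
      ≈⟨ sumFin-cong (suc n) (λ l → ≡⇒≃ (cong (λ l′ → sign (toℕ k) (sign (toℕ l′)
           (A k *ₚ (A (punchIn k l) *ₚ det n (minor₂ k l′))))) (sym (punchOut′-punchIn k l)))) ⟩
    sumFin (suc n) (λ l → term k (punchIn k l)) ∎
    where
    B : Fin (suc n) → Poly
    B l = M 1F (punchIn k l)
    D : Fin (suc n) → Poly
    D l = det n (minor₂ k l)

  term-antisym : ∀ k b → toℕ k ℕ.< toℕ b → term k b +ₚ term b k ≃ []
  term-antisym k b k<b = begin
    term k b +ₚ term b k
      ≈⟨ +ₚ-cong (≃-refl {term k b}) (sign-cong (toℕ b) (sign-cong (toℕ (punchOut′ b k)) swap)) ⟩
    term k b +ₚ sign (toℕ b) (sign (toℕ (punchOut′ b k)) P)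
      ≈⟨ sign-cancel (toℕ k) (toℕ (punchOut′ k b)) (toℕ b) (toℕ (punchOut′ b k)) P (punchOut′-parity k b k<b) ⟩
    [] ∎
    where
    P = A k *ₚ (A b *ₚ det n (minor₂ k (punchOut′ k b)))
    swap : A b *ₚ (A k *ₚ det n (minor₂ b (punchOut′ b k))) ≃ P
    swap = ≃-trans (solve 3 (λ x y d → x :* (y :* d) := y :* (x :* d)) ≃-refl (A b) (A k) _)
      (*ₚ-cong (≃-refl {A k}) (*ₚ-cong (≃-refl {A b}) (det-cong n (λ r c →
        ≡⇒≃ (cong (M (Fin.suc (Fin.suc r))) (sym (punchIn-punchOut′-comm k b (k≢b) c)))))))
      where k≢b = λ k≡b → ℕ.<-irrefl (cong toℕ k≡b) k<b

  antisym : ∀ k b → k ≢ b → term k b +ₚ term b k ≃ []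
  antisym k b k≢b with ℕ.<-cmp (toℕ k) (toℕ b)
  ... | tri< k<b _ _ = term-antisym k b k<b
  ... | tri≈ _ k≡b _ = ⊥-elim (k≢b (toℕ-injective k≡b))
  ... | tri> _ _ b<k = ≃-trans (+ₚ-comm (term k b) (term b k)) (term-antisym b k b<k)

det-linear-row₀ : ∀ m (U W : Fin (suc m) → Poly) (M : Fin (suc m) → Fin (suc m) → Poly) →
  det (suc m) ((λ k → U k +ₚ W k) V.∷ V.tail M) ≃ det (suc m) (U V.∷ V.tail M) +ₚ det (suc m) (W V.∷ V.tail M)
det-linear-row₀ m U W M = ≃-trans
  (sumFin-cong (suc m) λ k →
    ≃-trans (sign-cong (toℕ k) (*ₚ-distribʳ (U k) (W k) (minor k))) (sign-+ₚ (toℕ k) (U k *ₚ minor k) (W k *ₚ minor k)))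
  (sumFin-+ₚ (suc m) (λ k → sign (toℕ k) (U k *ₚ minor k)) (λ k → sign (toℕ k) (W k *ₚ minor k)))
  where
  minor : Fin (suc m) → Poly
  minor k = det m (λ r c → M (Fin.suc r) (punchIn k c))

-- Threshold matrices

-- The off-diagonal (j , k) entry of `thresholdMatrix d c` is `c (max j k)`.
thresholdMatrix : ∀ {n} → (d c : Fin n → Poly) → Fin n → Fin n → Poly
thresholdMatrix d c Fin.zero    Fin.zero    = d Fin.zero
thresholdMatrix d c Fin.zero    (Fin.suc k) = c (Fin.suc k)
thresholdMatrix d c (Fin.suc j) Fin.zero    = c (Fin.suc j)
thresholdMatrix d c (Fin.suc j) (Fin.suc k) = thresholdMatrix (V.tail d) (V.tail c) j k

thresholdMatrix-cong : ∀ {n} {d d′ c c′ : Fin (suc n) → Poly} →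
  (∀ r → d r ≃ d′ r) → (∀ r → c (Fin.suc r) ≃ c′ (Fin.suc r)) →
  ∀ j k → thresholdMatrix d c j k ≃ thresholdMatrix d′ c′ j k
thresholdMatrix-cong d≃ c≃ Fin.zero    Fin.zero    = d≃ Fin.zero
thresholdMatrix-cong d≃ c≃ Fin.zero    (Fin.suc k) = c≃ k
thresholdMatrix-cong d≃ c≃ (Fin.suc j) Fin.zero    = c≃ j
thresholdMatrix-cong {suc n} d≃ c≃ (Fin.suc j) (Fin.suc k) =
  thresholdMatrix-cong (d≃ ∘ Fin.suc) (c≃ ∘ Fin.suc) j k

thresholdMatrix-diagonal : ∀ {n} (d c : Fin n → Poly) j k → toℕ j ≡ toℕ k → thresholdMatrix d c j k ≡ d j
thresholdMatrix-diagonal d c Fin.zero    Fin.zero    _ = refl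
thresholdMatrix-diagonal d c (Fin.suc j) (Fin.suc k) e = thresholdMatrix-diagonal _ _ j k (ℕ.suc-injective e)

thresholdMatrix-below : ∀ {n} (d c : Fin n → Poly) j k → toℕ k ℕ.< toℕ j → thresholdMatrix d c j k ≡ c j
thresholdMatrix-below d c (Fin.suc j) Fin.zero    _         = refl
thresholdMatrix-below d c (Fin.suc j) (Fin.suc k) (s≤s k<j) = thresholdMatrix-below _ _ j k k<j

thresholdMatrix-above : ∀ {n} (d c : Fin n → Poly) j k → toℕ j ℕ.< toℕ k → thresholdMatrix d c j k ≡ c k
thresholdMatrix-above d c Fin.zero    (Fin.suc k) _         = refl
thresholdMatrix-above d c (Fin.suc j) (Fin.suc k) (s≤s j<k) = thresholdMatrix-above _ _ j k j<k

-- Subtracting the second row from the first leaves (d₀ - c₁ , c₁ - d₁ , 0 , … , 0).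
det-thresholdMatrix : ∀ n (d c : Fin (suc (suc n)) → Poly) →
  det (suc (suc n)) (thresholdMatrix d c) ≃
    (d Fin.zero +ₚ negₚ (c 1F)) *ₚ det (suc n) (thresholdMatrix (V.tail d) (V.tail c))
    +ₚ (d 1F +ₚ negₚ (c 1F)) *ₚ det (suc n) (thresholdMatrix (c 1F V.∷ V.tail (V.tail d)) (V.tail c))
det-thresholdMatrix n d c = begin
  det (suc (suc n)) M
    ≈⟨ det-cong (suc (suc n)) row₀-split ⟩
  det (suc (suc n)) ((λ k → R k +ₚ M₁ k) V.∷ V.tail M)
    ≈⟨ det-linear-row₀ (suc n) R M₁ M ⟩
  det (suc (suc n)) (R V.∷ V.tail M) +ₚ det (suc (suc n)) (M₁ V.∷ V.tail M)
    ≈⟨ +ₚ-cong (≃-refl {det (suc (suc n)) (R V.∷ V.tail M)}) (det-repeatedRow n (M₁ V.∷ V.tail M) (λ _ → ≃-refl)) ⟩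
  det (suc (suc n)) (R V.∷ V.tail M) +ₚ []
    ≈⟨ +ₚ-identityʳ _ ⟩
  R₀ *ₚ D₀ +ₚ (negₚ (R₁ *ₚ minor 1F) +ₚ rest)
    ≈⟨ +ₚ-cong (≃-refl {R₀ *ₚ D₀}) (+ₚ-cong (negₚ-cong (*ₚ-cong (≃-refl {R₁}) (det-cong (suc n) minor₁))) rest≃0) ⟩
  R₀ *ₚ D₀ +ₚ (negₚ (R₁ *ₚ D₁) +ₚ [])
    ≈⟨ +ₚ-cong (≃-refl {R₀ *ₚ D₀}) (+ₚ-identityʳ _) ⟩
  R₀ *ₚ D₀ +ₚ negₚ (R₁ *ₚ D₁)
    ≈⟨ +ₚ-cong (≃-refl {R₀ *ₚ D₀}) (solve 3 (λ d₁ c₁ D₁ → :- ((c₁ :+ :- d₁) :* D₁) := (d₁ :+ :- c₁) :* D₁) ≃-refl d₁ c₁ D₁) ⟩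
  R₀ *ₚ D₀ +ₚ (d₁ +ₚ negₚ c₁) *ₚ D₁
    ∎
  where
  open ≃-Reasoning
  M : Fin (suc (suc n)) → Fin (suc (suc n)) → Poly
  M = thresholdMatrix d c
  M₀ M₁ R : Fin (suc (suc n)) → Poly
  M₀ = M Fin.zero
  M₁ = M 1F
  R k = M₀ k +ₚ negₚ (M₁ k)
  d₁ c₁ R₀ R₁ D₀ D₁ rest : Poly
  d₁ = d 1F
  c₁ = c 1F
  R₀ = R Fin.zero
  R₁ = R 1F
  D₀ = det (suc n) (thresholdMatrix (V.tail d) (V.tail c))
  D₁ = det (suc n) (thresholdMatrix (c₁ V.∷ V.tail (V.tail d)) (V.tail c))
  minor : Fin (suc (suc n)) → Poly
  minor k = det (suc n) (λ r c → M (Fin.suc r) (punchIn k c))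
  rest = sumFin n (λ k → sign (toℕ (Fin.suc (Fin.suc k))) (R (Fin.suc (Fin.suc k)) *ₚ minor (Fin.suc (Fin.suc k))))

  row₀-split : ∀ r k → M r k ≃ ((λ k → R k +ₚ M₁ k) V.∷ V.tail M) r k
  row₀-split Fin.zero    k = solve 2 (λ a b → a := (a :+ :- b) :+ b) ≃-refl (M₀ k) (M₁ k)
  row₀-split (Fin.suc r) k = ≃-refl

  minor₁ : ∀ r k → M (Fin.suc r) (punchIn 1F k) ≃ thresholdMatrix (c₁ V.∷ V.tail (V.tail d)) (V.tail c) r k
  minor₁ Fin.zero    Fin.zero    = ≃-refl
  minor₁ Fin.zero    (Fin.suc k) = ≃-refl
  minor₁ (Fin.suc r) Fin.zero    = ≃-refl
  minor₁ (Fin.suc r) (Fin.suc k) = ≃-refl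

  rest≃0 : rest ≃ []
  rest≃0 = sumFin-zero n λ k → sign-zero (toℕ (Fin.suc (Fin.suc k)))
    (*ₚ-cong (+ₚ-inverseʳ (c (Fin.suc (Fin.suc k)))) (≃-refl {minor (Fin.suc (Fin.suc k))}))

-- The diagonal test used by `charPoly` is local to its definition; unification names it here.
charPoly-unfold : ∀ n (A : Fin n → Fin n → ℤ) → Σ[ isDiag ∈ (Fin n → Fin n → Bool) ]
  charPoly n A ≡ det n (λ j k → (if isDiag j k then X else []) +ₚ negₚ (constₚ (A j k)))
charPoly-unfold n A = _ , refl

entry : Bool → Poly
entry b = negₚ (constₚ (if b then 1ℤ else 0ℤ))

shift : Bool → Poly
shift b = X +ₚ negₚ (entry b)

thresholdCharPoly-det : ∀ s →
  thresholdCharPoly s ≃ det (length s) (thresholdMatrix (λ _ → X) (entry ∘ lookup s))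
thresholdCharPoly-det s =
  ≃-trans (≡⇒≃ (proj₂ (charPoly-unfold (length s) (thresholdAdj s)))) (det-cong (length s) matrix≃)
  where
  isDiag : Fin (length s) → Fin (length s) → Bool
  isDiag = proj₁ (charPoly-unfold (length s) (thresholdAdj s))
  T : Fin (length s) → Fin (length s) → Poly
  T = thresholdMatrix (λ _ → X) (entry ∘ lookup s)
  X-0≃X : X +ₚ negₚ (constₚ 0ℤ) ≃ X
  X-0≃X = mk≃ λ { zero → refl ; (suc zero) → refl ; (suc (suc n)) → refl }
  matrix≃ : ∀ j k → (if isDiag j k then X else []) +ₚ negₚ (constₚ (thresholdAdj s j k)) ≃ T j k
  matrix≃ j k with toℕ j ℕ.≟ toℕ k | toℕ k ℕ.<? toℕ j | toℕ j ℕ.<? toℕ k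
  ... | yes j≡k | yes k<j | _       = ⊥-elim (ℕ.<-irrefl (sym j≡k) k<j)
  ... | yes j≡k | no _    | yes j<k = ⊥-elim (ℕ.<-irrefl j≡k j<k)
  ... | yes j≡k | no _    | no _    = ≃-trans X-0≃X (≡⇒≃ (sym (thresholdMatrix-diagonal _ _ j k j≡k)))
  ... | no _    | yes k<j | _       = ≡⇒≃ (sym (thresholdMatrix-below _ _ j k k<j))
  ... | no _    | no _    | yes j<k = ≡⇒≃ (sym (thresholdMatrix-above _ _ j k j<k))
  ... | no j≢k  | no k≮j  | no j≮k  = ⊥-elim (j≢k (ℕ.≤-antisym (ℕ.≮⇒≥ k≮j) (ℕ.≮⇒≥ j≮k)))

-- The determinant of the characteristic matrix of the threshold graph of `b ∷ s` (for any `b`),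
-- with its first diagonal entry `X` replaced by `y`.
thresholdDet : Poly → List Bool → Poly
thresholdDet y s = det (suc (length s)) (thresholdMatrix (y V.∷ λ _ → X) ([] V.∷ entry ∘ lookup s))

χ : List Bool → Poly
χ []      = constₚ 1ℤ
χ (_ ∷ s) = thresholdDet X s

det-thresholdMatrix≃thresholdDet : ∀ y s (d c : Fin (suc (length s)) → Poly) →
  d Fin.zero ≃ y → (∀ r → d (Fin.suc r) ≃ X) → (∀ r → c (Fin.suc r) ≃ entry (lookup s r)) →
  det (suc (length s)) (thresholdMatrix d c) ≃ thresholdDet y s
det-thresholdMatrix≃thresholdDet y s d c d₀≃y dₛ≃X cₛ≃ =
  det-cong (suc (length s)) (thresholdMatrix-cong {d = d} {y V.∷ λ _ → X} {c} {[] V.∷ entry ∘ lookup s}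
    (λ { Fin.zero → d₀≃y ; (Fin.suc r) → dₛ≃X r }) cₛ≃)

thresholdCharPoly≃χ : ∀ s → thresholdCharPoly s ≃ χ s
thresholdCharPoly≃χ []      = ≃-refl
thresholdCharPoly≃χ (b ∷ s) = ≃-trans (thresholdCharPoly-det (b ∷ s))
  (det-thresholdMatrix≃thresholdDet X s (λ _ → X) (entry ∘ lookup (b ∷ s)) ≃-refl (λ _ → ≃-refl) (λ _ → ≃-refl))

thresholdDet-∷ : ∀ y b s → thresholdDet y (b ∷ s) ≃
  (y +ₚ negₚ (entry b)) *ₚ χ (b ∷ s) +ₚ shift b *ₚ thresholdDet (entry b) s
thresholdDet-∷ y b s = ≃-trans (det-thresholdMatrix (length s) d c)
  (+ₚ-cong (*ₚ-cong (≃-refl {y +ₚ negₚ (entry b)})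
             (det-thresholdMatrix≃thresholdDet X s (V.tail d) (V.tail c) ≃-refl (λ _ → ≃-refl) (λ _ → ≃-refl)))
           (*ₚ-cong (≃-refl {shift b})
             (det-thresholdMatrix≃thresholdDet (entry b) s (entry b V.∷ V.tail (V.tail d)) (V.tail c)
               ≃-refl (λ _ → ≃-refl) (λ _ → ≃-refl))))
  where
  d c : Fin (suc (suc (length s))) → Poly
  d = y V.∷ λ _ → X
  c = [] V.∷ entry ∘ lookup (b ∷ s)

thresholdDet-[] : ∀ y → thresholdDet y [] ≃ y
thresholdDet-[] y = ≃-trans (+ₚ-identityʳ (y *ₚ constₚ 1ℤ)) (*ₚ-identityʳ y)

thresholdDet-linear : ∀ y s → thresholdDet y s ≃ thresholdDet X s +ₚ (y +ₚ negₚ X) *ₚ χ s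
thresholdDet-linear y [] = begin
  thresholdDet y []                                     ≈⟨ thresholdDet-[] y ⟩
  y                                                     ≈⟨ solve 2 (λ y x → y := x :+ (y :+ :- x) :* con 1ℤ) ≃-refl y X ⟩
  X +ₚ (y +ₚ negₚ X) *ₚ constₚ 1ℤ                       ≈⟨ +ₚ-cong (≃-sym (thresholdDet-[] X)) (≃-refl {(y +ₚ negₚ X) *ₚ constₚ 1ℤ}) ⟩
  thresholdDet X [] +ₚ (y +ₚ negₚ X) *ₚ constₚ 1ℤ       ∎
  where open ≃-Reasoning
thresholdDet-linear y (b ∷ s) = begin
  thresholdDet y (b ∷ s)
    ≈⟨ thresholdDet-∷ y b s ⟩
  (y +ₚ negₚ c) *ₚ χ (b ∷ s) +ₚ (X +ₚ negₚ c) *ₚ D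
    ≈⟨ solve 5 (λ y x c E D → (y :+ :- c) :* E :+ (x :+ :- c) :* D
                              := ((x :+ :- c) :* E :+ (x :+ :- c) :* D) :+ (y :+ :- x) :* E)
         ≃-refl y X c (χ (b ∷ s)) D ⟩
  ((X +ₚ negₚ c) *ₚ χ (b ∷ s) +ₚ (X +ₚ negₚ c) *ₚ D) +ₚ (y +ₚ negₚ X) *ₚ χ (b ∷ s)
    ≈⟨ +ₚ-cong (≃-sym (thresholdDet-∷ X b s)) (≃-refl {(y +ₚ negₚ X) *ₚ χ (b ∷ s)}) ⟩
  thresholdDet X (b ∷ s) +ₚ (y +ₚ negₚ X) *ₚ χ (b ∷ s)
    ∎
  where
  open ≃-Reasoning
  c D : Poly
  c = entry b
  D = thresholdDet c s

χ-∷∷ : ∀ b₀ b s → χ (b₀ ∷ b ∷ s) ≃ constₚ (+ 2) *ₚ shift b *ₚ χ (b₀ ∷ s) +ₚ negₚ (shift b *ₚ shift b *ₚ χ s)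
χ-∷∷ b₀ b s = begin
  thresholdDet X (b ∷ s)
    ≈⟨ thresholdDet-∷ X b s ⟩
  shift b *ₚ E +ₚ shift b *ₚ thresholdDet (entry b) s
    ≈⟨ +ₚ-cong (≃-refl {shift b *ₚ E}) (*ₚ-cong (≃-refl {shift b}) (thresholdDet-linear (entry b) s)) ⟩
  shift b *ₚ E +ₚ shift b *ₚ (E +ₚ (entry b +ₚ negₚ X) *ₚ χ s)
    ≈⟨ solve 4 (λ x c E F → (x :+ :- c) :* E :+ (x :+ :- c) :* (E :+ (c :+ :- x) :* F)
                          := con (+ 2) :* (x :+ :- c) :* E :+ :- ((x :+ :- c) :* (x :+ :- c) :* F))
         ≃-refl X (entry b) E (χ s) ⟩
  constₚ (+ 2) *ₚ shift b *ₚ E +ₚ negₚ (shift b *ₚ shift b *ₚ χ s)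
    ∎
  where
  open ≃-Reasoning
  E : Poly
  E = thresholdDet X s

-- Closed forms, stated over any ring signature so that the ring solver can also read them as
-- syntax; `κ` embeds the integer constants.
module ClosedForms {c ℓ} (R : RawRing c ℓ) (κ : ℤ → RawRing.Carrier R) where
  open RawRing R
  open import Algebra.Definitions.RawSemiring rawSemiring using (_^_)

  -- The two rows of [[2a , -a²] , [1 , 0]]^(m+1) applied to (e , f), for P = aᵐ and K = m.
  runχ₀ runχ : (a P K e f : Carrier) → Carrier
  runχ₀ a P K e f = a * P * ((K + κ (+ 2)) * e + - ((K + κ (+ 1)) * a * f))
  runχ  a P K e f = P * ((K + κ (+ 1)) * e + - (K * a * f))

  -- The four runs of `seqG (1 + j)` after its first vertex, with J = j, P = xʲ and Q = (x + 1)ʲ.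
  seqGForm : (x J P Q : Carrier) → Carrier
  seqGForm x J P Q = runχ₀ x (P ^ 2 * x ^ 1) (lin 2 1) e₂ f₂
    where
    x+1 e₄ f₄ e₃ f₃ e₂ f₂ : Carrier
    lin : ℕ → ℕ → Carrier
    lin α β = J * κ (+ α) + κ (+ β)
    x+1 = x + κ 1ℤ
    e₄ = runχ₀ x+1 (Q ^ 2 * x+1 ^ 1) (lin 2 1) x (κ 1ℤ)
    f₄ = runχ  x+1 (Q ^ 2 * x+1 ^ 1) (lin 2 1) x (κ 1ℤ)
    e₃ = runχ₀ x (P ^ 2 * x ^ 2) (lin 2 2) e₄ f₄
    f₃ = runχ  x (P ^ 2 * x ^ 2) (lin 2 2) e₄ f₄
    e₂ = runχ₀ x+1 (Q ^ 3 * x+1 ^ 5) (lin 3 5) e₃ f₃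
    f₂ = runχ  x+1 (Q ^ 3 * x+1 ^ 5) (lin 3 5) e₃ f₃

  claimedForm : (x J P Q : Carrier) → Carrier
  claimedForm x J P Q =
    P ^ 4 * x ^ 4 * (Q ^ 5 * (x + κ 1ℤ) ^ 6) * (x + (κ (+ 2) * i + κ (+ 1)))
    * (x ^ 3 + - ((κ (+ 7) * i + κ (+ 2)) * x ^ 2) + - ((κ (+ 7) * i + κ (+ 3)) * x)
       + (κ (+ 12) * i * i * i + κ (+ 18) * i * i + κ (+ 6) * i))
    where
    i : Carrier
    i = κ (+ 1) + J

open ClosedForms (CommutativeRing.rawRing ℤ[X]) constₚ

syntaxRawRing : ℕ → RawRing _ _
syntaxRawRing n = record
  { Carrier = Polynomial n ; _≈_ = _≡_ ; _+_ = _:+_ ; _*_ = _:*_ ; -_ = :-_ ; 0# = con 0ℤ ; 1# = con 1ℤ }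

module Syntax {n : ℕ} = ClosedForms (syntaxRawRing n) con

χ-run : ∀ b₀ b m s →
  χ (b₀ ∷ replicate (suc m) b ++ s) ≃ runχ₀ (shift b) (shift b ^ₚ m) (constₚ (+ m)) (χ (b₀ ∷ s)) (χ s)
  × χ (replicate (suc m) b ++ s) ≃ runχ (shift b) (shift b ^ₚ m) (constₚ (+ m)) (χ (b₀ ∷ s)) (χ s)
χ-run b₀ b zero s =
    ≃-trans (χ-∷∷ b₀ b s) (solve 3 (λ a e f → con (+ 2) :* a :* e :+ :- (a :* a :* f)
                                             := Syntax.runχ₀ a (con 1ℤ) (con (+ 0)) e f) ≃-refl (shift b) (χ (b₀ ∷ s)) (χ s))
  , solve 3 (λ a e f → e := Syntax.runχ a (con 1ℤ) (con (+ 0)) e f) ≃-refl (shift b) (χ (b₀ ∷ s)) (χ s)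
χ-run b₀ b (suc m) s =
    (begin
      χ (b₀ ∷ b ∷ r)
        ≈⟨ χ-∷∷ b₀ b r ⟩
      constₚ (+ 2) *ₚ a *ₚ χ (b₀ ∷ r) +ₚ negₚ (a *ₚ a *ₚ χ r)
        ≈⟨ +ₚ-cong (*ₚ-cong (≃-refl {constₚ (+ 2) *ₚ a}) (proj₁ ih)) (negₚ-cong (*ₚ-cong (≃-refl {a *ₚ a}) (proj₂ ih))) ⟩
      constₚ (+ 2) *ₚ a *ₚ runχ₀ a P K e f +ₚ negₚ (a *ₚ a *ₚ runχ a P K e f)
        ≈⟨ solve 5 (λ a P K e f → con (+ 2) :* a :* Syntax.runχ₀ a P K e f :+ :- (a :* a :* Syntax.runχ a P K e f)
                                 := Syntax.runχ₀ a (a :* P) (con (+ 1) :+ K) e f) ≃-refl a P K e f ⟩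
      runχ₀ a (a *ₚ P) (constₚ (+ suc m)) e f
        ∎)
  , ≃-trans (proj₁ ih) (solve 5 (λ a P K e f → Syntax.runχ₀ a P K e f := Syntax.runχ a (a :* P) (con (+ 1) :+ K) e f)
                                 ≃-refl a P K e f)
  where
  open ≃-Reasoning
  r : List Bool
  r = replicate (suc m) b ++ s
  ih : χ (b₀ ∷ r) ≃ runχ₀ (shift b) (shift b ^ₚ m) (constₚ (+ m)) (χ (b₀ ∷ s)) (χ s)
     × χ r ≃ runχ (shift b) (shift b ^ₚ m) (constₚ (+ m)) (χ (b₀ ∷ s)) (χ s)
  ih = χ-run b₀ b m s
  a P K e f : Poly
  a = shift b
  P = shift b ^ₚ m
  K = constₚ (+ m)
  e = χ (b₀ ∷ s)
  f = χ s

open import Algebra.Properties.Semiring.Exp (CommutativeRing.semiring ℤ[X])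
  using (_^_; ^-congˡ; ^-homo-*; ^-assocʳ)

^ₚ≃^ : ∀ p n → p ^ₚ n ≃ p ^ n
^ₚ≃^ p zero    = ≃-refl
^ₚ≃^ p (suc n) = *ₚ-cong (≃-refl {p}) (^ₚ≃^ p n)

^ₚ-linear : ∀ {p q} n j α β → p ≃ q → n ≡ j ℕ.* α ℕ.+ β → p ^ₚ n ≃ (q ^ j) ^ α *ₚ q ^ β
^ₚ-linear {p} {q} n j α β p≃q refl = begin
  p ^ₚ n                        ≈⟨ ^ₚ≃^ p n ⟩
  p ^ n                         ≈⟨ ^-congˡ n p≃q ⟩
  q ^ (j ℕ.* α ℕ.+ β)           ≈⟨ ^-homo-* q (j ℕ.* α) β ⟩
  q ^ (j ℕ.* α) *ₚ q ^ β        ≈⟨ *ₚ-cong (≃-sym (^-assocʳ q j α)) (≃-refl {q ^ β}) ⟩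
  (q ^ j) ^ α *ₚ q ^ β          ∎
  where open ≃-Reasoning

constₚ-* : ∀ m n → constₚ (+ (m ℕ.* n)) ≃ constₚ (+ m) *ₚ constₚ (+ n)
constₚ-* m n = ≃-trans (≡⇒≃ (cong constₚ (ℤ.pos-* m n))) (∷-cong (sym (ℤ.+-identityʳ _)) ≃-refl)

constₚ-*ʳ : ∀ m n {p} → constₚ (+ m) ≃ p → constₚ (+ (m ℕ.* n)) ≃ p *ₚ constₚ (+ n)
constₚ-*ʳ m n m≃p = ≃-trans (constₚ-* m n) (*ₚ-cong m≃p (≃-refl {constₚ (+ n)}))

constₚ-linear : ∀ {n} j α β → n ≡ j ℕ.* α ℕ.+ β → constₚ (+ n) ≃ constₚ (+ j) *ₚ constₚ (+ α) +ₚ constₚ (+ β)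
constₚ-linear j α β refl = +ₚ-cong (constₚ-* j α) (≃-refl {constₚ (+ β)})

scaleₚ≃constₚ-*ₚ : ∀ c p → scaleₚ c p ≃ constₚ c *ₚ p
scaleₚ≃constₚ-*ₚ c p = ≃-sym (≃-trans (+ₚ-cong (≃-refl {scaleₚ c p}) [0]≃[]) (+ₚ-identityʳ (scaleₚ c p)))

χ-run≃ : ∀ b₀ b m {s a P K e f} → shift b ≃ a → shift b ^ₚ m ≃ P → constₚ (+ m) ≃ K →
  χ (b₀ ∷ s) ≃ e × χ s ≃ f →
  χ (b₀ ∷ replicate (suc m) b ++ s) ≃ runχ₀ a P K e f × χ (replicate (suc m) b ++ s) ≃ runχ a P K e f
χ-run≃ b₀ b m {s} a≃ P≃ K≃ (e≃ , f≃) =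
    ≃-trans (proj₁ (χ-run b₀ b m s)) (*ₚ-cong (*ₚ-cong a≃ P≃) (+ₚ-cong
      (*ₚ-cong (+ₚ-cong K≃ ≃-refl) e≃) (negₚ-cong (*ₚ-cong (*ₚ-cong (+ₚ-cong K≃ ≃-refl) a≃) f≃))))
  , ≃-trans (proj₂ (χ-run b₀ b m s)) (*ₚ-cong P≃ (+ₚ-cong
      (*ₚ-cong (+ₚ-cong K≃ ≃-refl) e≃) (negₚ-cong (*ₚ-cong (*ₚ-cong K≃ a≃) f≃))))

shift-false : shift false ≃ X
shift-false = solve 1 (λ x → x :+ :- (:- con 0ℤ) := x) ≃-refl X

shift-true : shift true ≃ X +ₚ constₚ 1ℤ
shift-true = solve 1 (λ x → x :+ :- (:- con 1ℤ) := x :+ con 1ℤ) ≃-refl X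

seqG-runs : ∀ j → seqG (suc j) ≡
  false ∷ replicate (suc (j ℕ.* 2 ℕ.+ 1)) false ++ replicate (suc (j ℕ.* 3 ℕ.+ 5)) true
        ++ replicate (suc (suc (j ℕ.* 2 ℕ.+ 1))) false ++ replicate (suc (j ℕ.* 2 ℕ.+ 1)) true ++ []
seqG-runs j =
  cong₂ _++_ (replicate-≡ (run₁ j)) (cong₂ _++_ (replicate-≡ (run₂ j)) (cong₂ _++_ (replicate-≡ (run₁ j))
    (trans (replicate-≡ (run₄ j)) (sym (List.++-identityʳ _)))))
  where
  replicate-≡ : ∀ {m n} {b : Bool} → m ≡ n → replicate m b ≡ replicate n b
  replicate-≡ {b = b} = cong (λ k → replicate k b)
  run₁ : ∀ j → 2 ℕ.* suc j ℕ.+ 1 ≡ suc (suc (j ℕ.* 2 ℕ.+ 1))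
  run₁ = solve-∀
  run₂ : ∀ j → 3 ℕ.* suc j ℕ.+ 3 ≡ suc (j ℕ.* 3 ℕ.+ 5)
  run₂ = solve-∀
  run₄ : ∀ j → 2 ℕ.* suc j ≡ suc (j ℕ.* 2 ℕ.+ 1)
  run₄ = solve-∀

χ-seqG : ∀ j → thresholdCharPoly (seqG (suc j)) ≃ seqGForm X (constₚ (+ j)) (X ^ j) ((X +ₚ constₚ 1ℤ) ^ j)
χ-seqG j =
  ≃-trans (≡⇒≃ (cong thresholdCharPoly (seqG-runs j)))
  (≃-trans (thresholdCharPoly≃χ (false ∷ L₁)) (proj₁
    (χ-run≃ false false (j ℕ.* 2 ℕ.+ 1) {L₂} shift-false (^ₚ-linear _ j 2 1 shift-false refl) (constₚ-linear j 2 1 refl)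
    (χ-run≃ false true (j ℕ.* 3 ℕ.+ 5) {L₃} shift-true (^ₚ-linear _ j 3 5 shift-true refl) (constₚ-linear j 3 5 refl)
    (χ-run≃ false false (suc (j ℕ.* 2 ℕ.+ 1)) {L₄} shift-false (^ₚ-linear _ j 2 2 shift-false m₃) (constₚ-linear j 2 2 m₃)
    (χ-run≃ false true (j ℕ.* 2 ℕ.+ 1) {[]} shift-true (^ₚ-linear _ j 2 1 shift-true refl) (constₚ-linear j 2 1 refl)
    (thresholdDet-[] X , ≃-refl)))))))
  where
  L₁ L₂ L₃ L₄ : List Bool
  L₁ = replicate (suc (j ℕ.* 2 ℕ.+ 1)) false ++ L₂
  L₂ = replicate (suc (j ℕ.* 3 ℕ.+ 5)) true ++ L₃
  L₃ = replicate (suc (suc (j ℕ.* 2 ℕ.+ 1))) false ++ L₄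
  L₄ = replicate (suc (j ℕ.* 2 ℕ.+ 1)) true ++ []
  m₃ : suc (j ℕ.* 2 ℕ.+ 1) ≡ j ℕ.* 2 ℕ.+ 2
  m₃ = sym (ℕ.+-suc (j ℕ.* 2) 1)

claimedPoly≃claimedForm : ∀ j → claimedPoly (suc j) ≃ claimedForm X (constₚ (+ j)) (X ^ j) ((X +ₚ constₚ 1ℤ) ^ j)
claimedPoly≃claimedForm j =
  *ₚ-cong (*ₚ-cong (*ₚ-cong
    (^ₚ-linear (4 ℕ.* i) j 4 4 ≃-refl (4i j))
    (^ₚ-linear (5 ℕ.* i ℕ.+ 1) j 5 6 ≃-refl (5i+1 j)))
    (+ₚ-cong (≃-refl {X}) (+ₚ-cong (constₚ-* 2 i) (≃-refl {constₚ (+ 1)}))))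
    (+ₚ-cong (+ₚ-cong (+ₚ-cong (≃-refl {X ^ₚ 3})
      (negₚ-cong (≃-trans (scaleₚ≃constₚ-*ₚ (ι (7 ℕ.* i ℕ.+ 2)) (X ^ₚ 2))
        (*ₚ-cong (+ₚ-cong (constₚ-* 7 i) (≃-refl {constₚ (+ 2)})) (≃-refl {X ^ₚ 2})))))
      (negₚ-cong (≃-trans (scaleₚ≃constₚ-*ₚ (ι (7 ℕ.* i ℕ.+ 3)) X)
        (*ₚ-cong (+ₚ-cong (constₚ-* 7 i) (≃-refl {constₚ (+ 3)})) (≃-refl {X})))))
      (+ₚ-cong (+ₚ-cong (constₚ-*ʳ _ i (constₚ-*ʳ _ i (constₚ-* 12 i))) (constₚ-*ʳ _ i (constₚ-* 18 i)))
               (constₚ-* 6 i)))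
  where
  i : ℕ
  i = suc j
  4i : ∀ j → 4 ℕ.* suc j ≡ j ℕ.* 4 ℕ.+ 4
  4i = solve-∀
  5i+1 : ∀ j → 5 ℕ.* suc j ℕ.+ 1 ≡ j ℕ.* 5 ℕ.+ 6
  5i+1 = solve-∀

thresholdCharPoly-seqG : ∀ j → thresholdCharPoly (seqG (suc j)) ≃ claimedPoly (suc j)
thresholdCharPoly-seqG j = ≃-trans (χ-seqG j) (≃-trans
  (solve 4 (λ x J P Q → Syntax.seqGForm x J P Q := Syntax.claimedForm x J P Q) ≃-refl X J P Q)
  (≃-sym (claimedPoly≃claimedForm j)))
  where
  J P Q : Poly
  J = constₚ (+ j)
  P = X ^ j
  Q = (X +ₚ constₚ 1ℤ) ^ j

lemma1 : (i : ℕ) → i ≥ 1 →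
    (thresholdCharPoly (seqG i) ≈ₚ claimedPoly i)
    ⊎ (thresholdCharPoly (seqG i) ≈ₚ negₚ (claimedPoly i))
lemma1 (suc j) _ = inj₁ (≃⇒≈ₚ (thresholdCharPoly-seqG j))
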